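{- Let $f$ be a Boolean predicate. If $\{f\}$ simultaneously-implements the predicate $\mathrm{XOR}$ on two variables, then $\{f\}$ also simultaneously-implements the predicate $\mathrm{NAE}$ on three variables.
   Context: $\mathrm{XOR}(x,y)$ is true iff $x\ne y$; $\mathrm{NAE}(x_1,x_2,x_3)$ is false iff $x_1=x_2=x_3$. Simultaneous-implementation: let $x_1,\dots,x_w$ (primary) and $y_1,\dots,y_t$ (auxiliary) be Boolean variables and $P:\{0,1\}^w\to\{\mathrm{true},\mathrm{false}\}$. Collections $\mathcal C_1,\dots,\mathcal C_k$ of constraints on $\{x_1,\dots,x_w,y_1,\dots,y_t\}$, each an application of a predicate to a tuple of distinct variables, simultaneously-implement $P$ if for every assignment to the $x$'s: if $P$ is true, some setting of the $y$'s gives each $\mathcal C_i$ at least one satisfied constraint; if $P$ is false, for every setting of the $y$'s some $\mathcal C_i$ has no satisfied constraint. $\{f\}$ simultaneously-implements $P$ if such a simultaneous-implementation exists with all constraints applications of $f$. -}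

module Defs where

open import Data.Bool using (Bool; true; false; not; _xor_; _∧_; _∨_)
open import Data.Nat using (ℕ)
open import Data.Fin using (Fin; _↑ˡ_; _↑ʳ_)
open import Data.Vec using (Vec; []; _∷_; map; lookup)
open import Data.List using (List)
open import Data.List.Relation.Unary.Any using (Any)
open import Data.List.Relation.Unary.All using (All)
open import Data.Vec.Relation.Unary.Unique.Propositional using (Unique)
open import Data.Product using (Σ; ∃; _×_)
open import Relation.Binary.PropositionalEquality using (_≡_)

Predicate : ℕ → Set
Predicate r = Vec Bool r → Bool

XOR : Predicate 2
XOR (x ∷ y ∷ []) = x xor y

NAE : Predicate 3
NAE (x ∷ y ∷ z ∷ []) = not ((x ∧ y ∧ z) ∨ (not x ∧ not y ∧ not z))

-- A constraint built from f (arity r) on variables Fin n: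
-- an application of f to a tuple of r distinct variables.
record Constraint (r n : ℕ) : Set where
  constructor mkConstraint
  field
    scope    : Vec (Fin n) r
    distinct : Unique scope

open Constraint public

satisfied : ∀ {r n} → Predicate r → (Fin n → Bool) → Constraint r n → Set
satisfied f σ c = f (map σ (scope c)) ≡ true

-- Full assignment from primary values x (variables 0..w-1) and auxiliary
-- values y (variables w..w+t-1).
combine : ∀ {w t} → Vec Bool w → Vec Bool t → Fin (w Data.Nat.+ t) → Bool
combine {w} {t} x y i = Data.Sum.[ lookup x , lookup y ]′ (Data.Fin.splitAt w i)
  where import Data.Sum

SimImplementsBy : ∀ {r w} → Predicate r → Predicate w →
                  (t k : ℕ) → (Fin k → List (Constraint r (w Data.Nat.+ t))) → Set
SimImplementsBy {w = w} f P t k C =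
    (∀ (x : Vec Bool w) → P x ≡ true →
       ∃ λ (y : Vec Bool t) → ∀ i → Any (satisfied f (combine x y)) (C i))
  × (∀ (x : Vec Bool w) → P x ≡ false →
       ∀ (y : Vec Bool t) → ∃ λ i → All (λ c → satisfied f (combine x y) c → Data.Empty.⊥) (C i))
  where import Data.Empty

SimImplements : ∀ {r w} → Predicate r → Predicate w → Set
SimImplements {r} {w} f P =
  Σ ℕ λ t → Σ ℕ λ k → Σ (Fin k → List (Constraint r (w Data.Nat.+ t))) λ C →
    SimImplementsBy f P t k C

-- NAE(a, b, c) is XOR(a, b) ∨ XOR(b, c), so the theorem follows from two closure properties
-- of simultaneous implementation.  Selecting primary variables along an injection
-- preserves it: rename the gadget's variables accordingly.  A disjunction P ∨ Q is
-- implemented by gadgets for P and Q with disjoint auxiliary variables, taking as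
-- collections all unions C_i ∪ D_j: if P holds, the P-witness meets every C_i; if both
-- fail, an empty C_i and an empty D_j give an empty C_i ∪ D_j.
module Submission where

open import Defs
open import Data.Bool using (Bool; true; false; _∨_)
open import Data.Bool.Properties using (∨-conicalˡ; ∨-conicalʳ)
open import Data.Fin using (Fin; _↑ˡ_; _↑ʳ_; splitAt; remQuot)
import Data.Fin as Fin
open import Data.Fin.Properties using (↑ˡ-injective; ↑ʳ-injective; splitAt-join; +↔⊎; remQuot-combine)
open import Data.List using (List; _++_)
import Data.List as List
open import Data.List.Relation.Unary.All as All using (All)
import Data.List.Relation.Unary.All.Properties as All
open import Data.List.Relation.Unary.Any as Any using (Any)
import Data.List.Relation.Unary.Any.Properties as Any
open import Data.Nat using (ℕ; _+_; _*_)
open import Data.Product using (∃; _,_; proj₁; proj₂)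
open import Data.Sum using (_⊎_; inj₁; inj₂)
open import Data.Sum.Function.Propositional using (_⊎-↣_)
open import Data.Vec using (Vec; []; _∷_; lookup; tabulate; replicate) renaming (_++_ to _++ᵛ_)
open import Data.Vec.Properties using (map-∘; map-cong; lookup∘tabulate; lookup-++ˡ; lookup-++ʳ)
import Data.Vec as Vec
open import Data.Vec.Relation.Unary.Unique.Propositional.Properties using (map⁺)
open import Function using (_∘_; _⇔_; mk⇔)
open import Function.Bundles using (_↣_; mk↣; Injection; Equivalence)
open import Function.Construct.Composition using (_↣-∘_)
open import Function.Construct.Identity using (↣-id)
open import Function.Properties.Inverse using (↔⇒↣; ↔-sym)
open import Relation.Binary.PropositionalEquality
open import Relation.Nullary using (¬_)

open Injection using (to; injective)

private
  variable
    r n m w w′ t t′ k k′ : ℕ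

select : (Fin w → Fin w′) → Vec Bool w′ → Vec Bool w
select π x = tabulate (lookup x ∘ π)

rename : Fin n ↣ Fin m → Constraint r n → Constraint r m
rename ρ c = mkConstraint (Vec.map (to ρ) (scope c)) (map⁺ (injective ρ) (distinct c))

module _ (f : Predicate r) (ρ : Fin n ↣ Fin m) {σ : Fin m → Bool} {τ : Fin n → Bool}
         (σ∘ρ≗τ : ∀ i → σ (to ρ i) ≡ τ i) where

  rename-satisfied : ∀ c → satisfied f σ (rename ρ c) ⇔ satisfied f τ c
  rename-satisfied c = mk⇔ (trans (sym same)) (trans same)
    where
    same : f (Vec.map σ (Vec.map (to ρ) (scope c))) ≡ f (Vec.map τ (scope c))
    same = cong f (trans (sym (map-∘ σ (to ρ) (scope c))) (map-cong σ∘ρ≗τ (scope c)))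

  Any-rename : ∀ {cs} → Any (satisfied f τ) cs → Any (satisfied f σ) (List.map (rename ρ) cs)
  Any-rename = Any.map⁺ ∘ Any.map (λ {c} → Equivalence.from (rename-satisfied c))

  All-rename : ∀ {cs} → All (¬_ ∘ satisfied f τ) cs →
               All (¬_ ∘ satisfied f σ) (List.map (rename ρ) cs)
  All-rename = All.map⁺ ∘ All.map (λ {c} ¬sat → ¬sat ∘ Equivalence.to (rename-satisfied c))

↑ˡ-↣ : ∀ n → Fin m ↣ Fin (m + n)
↑ˡ-↣ n = mk↣ (↑ˡ-injective n _ _)

↑ʳ-↣ : ∀ n → Fin m ↣ Fin (n + m)
↑ʳ-↣ n = mk↣ (↑ʳ-injective n _ _)

_+↣_ : Fin w ↣ Fin w′ → Fin t ↣ Fin t′ → Fin (w + t) ↣ Fin (w′ + t′)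
π +↣ e = ↔⇒↣ (↔-sym +↔⊎) ↣-∘ ((π ⊎-↣ e) ↣-∘ ↔⇒↣ +↔⊎)

-- to (π +↣ e) computes to join w′ t′ ∘ Sum.map (to π) (to e) ∘ splitAt w.
combine-+↣ : (π : Fin w ↣ Fin w′) (e : Fin t ↣ Fin t′)
             (x : Vec Bool w′) (y : Vec Bool t′) (x′ : Vec Bool w) (y′ : Vec Bool t) →
             (∀ a → lookup x (to π a) ≡ lookup x′ a) →
             (∀ b → lookup y (to e b) ≡ lookup y′ b) →
             ∀ i → combine x y (to (π +↣ e) i) ≡ combine x′ y′ i
combine-+↣ {w} {w′} {t′ = t′} π e x y x′ y′ x≗x′ y≗y′ i with splitAt w i
... | inj₁ a rewrite splitAt-join w′ t′ (inj₁ (to π a)) = x≗x′ a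
... | inj₂ b rewrite splitAt-join w′ t′ (inj₂ (to e b)) = y≗y′ b

_⊗_ : {A : Set} → (Fin k → List A) → (Fin k′ → List A) → Fin (k * k′) → List A
(_⊗_ {k} {k′} C D) ij = C (proj₁ (remQuot {k} k′ ij)) ++ D (proj₂ (remQuot {k} k′ ij))

module _ {A : Set} (C : Fin k → List A) (D : Fin k′ → List A) where

  Any-⊗ˡ : ∀ {P : A → Set} → (∀ i → Any P (C i)) → ∀ ij → Any P ((C ⊗ D) ij)
  Any-⊗ˡ anyC ij = Any.++⁺ˡ (anyC _)

  Any-⊗ʳ : ∀ {P : A → Set} → (∀ j → Any P (D j)) → ∀ ij → Any P ((C ⊗ D) ij)
  Any-⊗ʳ anyD ij = Any.++⁺ʳ (C _) (anyD _)

  All-⊗ : ∀ {P : A → Set} {i j} → All P (C i) → All P (D j) → All P ((C ⊗ D) (Fin.combine i j))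
  All-⊗ {P} {i} {j} allC allD =
    subst (λ ij → All P (C (proj₁ ij) ++ D (proj₂ ij))) (sym (remQuot-combine i j))
          (All.++⁺ allC allD)

∨-true : ∀ a b → a ∨ b ≡ true → a ≡ true ⊎ b ≡ true
∨-true true  b _      = inj₁ refl
∨-true false b b≡true = inj₂ b≡true

module _ (f : Predicate r) where

  SimImplements-resp : {P Q : Predicate w} → (∀ x → P x ≡ Q x) →
                       SimImplements f P → SimImplements f Q
  SimImplements-resp P≗Q (t , k , C , complete , sound) =
    t , k , C , (λ x → complete x ∘ trans (P≗Q x)) , (λ x → sound x ∘ trans (P≗Q x))

  SimImplements-select : {P : Predicate w} (π : Fin w ↣ Fin w′) →
                         SimImplements f P → SimImplements f (P ∘ select (to π))
  SimImplements-select {P = P} π (t , k , C , complete , sound) =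
    t , k , List.map (rename ρ) ∘ C , complete′ , sound′
    where
    ρ : Fin (_ + t) ↣ Fin (_ + t)
    ρ = π +↣ ↣-id _

    selected : ∀ x y i → combine x y (to ρ i) ≡ combine (select (to π) x) y i
    selected x y =
      combine-+↣ π (↣-id _) x y (select (to π) x) y (sym ∘ lookup∘tabulate _) (λ _ → refl)

    complete′ : ∀ x → P (select (to π) x) ≡ true →
                ∃ λ y → ∀ i → Any (satisfied f (combine x y)) (List.map (rename ρ) (C i))
    complete′ x Px = let (y , sat) = complete (select (to π) x) Px
                     in y , λ i → Any-rename f ρ (selected x y) (sat i)

    sound′ : ∀ x → P (select (to π) x) ≡ false → ∀ y →
             ∃ λ i → All (¬_ ∘ satisfied f (combine x y)) (List.map (rename ρ) (C i))
    sound′ x ¬Px y = let (i , unsat) = sound (select (to π) x) ¬Px y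
                     in i , All-rename f ρ (selected x y) unsat

  SimImplements-∨ : {P Q : Predicate w} →
                    SimImplements f P → SimImplements f Q → SimImplements f (λ x → P x ∨ Q x)
  SimImplements-∨ {w} {P} {Q} (t , k , C , completeC , soundC) (t′ , k′ , D , completeD , soundD) =
    t + t′ , k * k′ , E , complete , sound
    where
    ρ : Fin (w + t) ↣ Fin (w + (t + t′))
    ρ = ↣-id (Fin w) +↣ ↑ˡ-↣ {t} t′

    ρ′ : Fin (w + t′) ↣ Fin (w + (t + t′))
    ρ′ = ↣-id (Fin w) +↣ ↑ʳ-↣ {t′} t

    C′ : Fin k → List (Constraint r (w + (t + t′)))
    C′ = List.map (rename ρ) ∘ C

    D′ : Fin k′ → List (Constraint r (w + (t + t′)))
    D′ = List.map (rename ρ′) ∘ D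

    E : Fin (k * k′) → List (Constraint r (w + (t + t′)))
    E = C′ ⊗ D′

    ρ-restricts : ∀ x y yC → (∀ b → lookup y (b ↑ˡ t′) ≡ lookup yC b) →
                  ∀ i → combine x y (to ρ i) ≡ combine x yC i
    ρ-restricts x y yC = combine-+↣ (↣-id (Fin w)) (↑ˡ-↣ {t} t′) x y x yC (λ _ → refl)

    ρ′-restricts : ∀ x y yD → (∀ b → lookup y (t ↑ʳ b) ≡ lookup yD b) →
                   ∀ i → combine x y (to ρ′ i) ≡ combine x yD i
    ρ′-restricts x y yD = combine-+↣ (↣-id (Fin w)) (↑ʳ-↣ {t′} t) x y x yD (λ _ → refl)

    complete : ∀ x → P x ∨ Q x ≡ true → ∃ λ y → ∀ ij → Any (satisfied f (combine x y)) (E ij)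
    complete x PQx with ∨-true (P x) (Q x) PQx
    ... | inj₁ Px = let (yC , sat) = completeC x Px
                        y = yC ++ᵛ replicate t′ false
                        y≗yC = lookup-++ˡ yC (replicate t′ false)
                    in y , Any-⊗ˡ C′ D′ (λ i → Any-rename f ρ (ρ-restricts x y yC y≗yC) (sat i))
    ... | inj₂ Qx = let (yD , sat) = completeD x Qx
                        y = replicate t false ++ᵛ yD
                        y≗yD = lookup-++ʳ (replicate t false) yD
                    in y , Any-⊗ʳ C′ D′ (λ j → Any-rename f ρ′ (ρ′-restricts x y yD y≗yD) (sat j))

    sound : ∀ x → P x ∨ Q x ≡ false → ∀ y → ∃ λ ij → All (¬_ ∘ satisfied f (combine x y)) (E ij)
    sound x ¬PQx y =
      let yC = select (_↑ˡ t′) y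
          yD = select (t ↑ʳ_) y
          (i , unsatC) = soundC x (∨-conicalˡ _ _ ¬PQx) yC
          (j , unsatD) = soundD x (∨-conicalʳ _ _ ¬PQx) yD
      in Fin.combine i j ,
         All-⊗ C′ D′ (All-rename f ρ  (ρ-restricts  x y yC (sym ∘ lookup∘tabulate _)) unsatC)
                     (All-rename f ρ′ (ρ′-restricts x y yD (sym ∘ lookup∘tabulate _)) unsatD)

NAE-as-XOR∨XOR : ∀ x → XOR (select (_↑ˡ 1) x) ∨ XOR (select (1 ↑ʳ_) x) ≡ NAE x
NAE-as-XOR∨XOR (true  ∷ true  ∷ true  ∷ []) = refl
NAE-as-XOR∨XOR (true  ∷ true  ∷ false ∷ []) = refl
NAE-as-XOR∨XOR (true  ∷ false ∷ c     ∷ []) = refl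
NAE-as-XOR∨XOR (false ∷ true  ∷ c     ∷ []) = refl
NAE-as-XOR∨XOR (false ∷ false ∷ true  ∷ []) = refl
NAE-as-XOR∨XOR (false ∷ false ∷ false ∷ []) = refl

lemmaA4 : ∀ {r : ℕ} (f : Predicate r) → SimImplements f XOR → SimImplements f NAE
lemmaA4 f xor =
  SimImplements-resp f NAE-as-XOR∨XOR
    (SimImplements-∨ f (SimImplements-select f (↑ˡ-↣ 1) xor)
                       (SimImplements-select f (↑ʳ-↣ 1) xor))
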